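{- Let $f\colon n\to m$ be a morphism of $\mathrm{Mat}_{\mathbb N}$ and $d$ a monoidal decomposition of $f$. Let $k\le m$ and $k'\le n$, and let $f_D=f;(\mathrm{id}_{m-k}\otimes\mathrm{del}_k)$ and $f_Z=(\mathrm{id}_{n-k'}\otimes\mathrm{zero}_{k'});f$ (i.e. $f_D$ is the matrix of $f$ with its last $k$ rows removed and $f_Z$ is the matrix of $f$ with its last $k'$ columns removed). Then there are monoidal decompositions $d_D$ of $f_D$ and $d_Z$ of $f_Z$ with $\mathrm{wd}(d_D)\le\mathrm{wd}(d)$ and $\mathrm{wd}(d_Z)\le\mathrm{wd}(d)$.
   Context: $\mathrm{Mat}_{\mathbb N}$ is the prop (strict symmetric monoidal category with objects the natural numbers, $m\otimes n=m+n$) whose morphisms $n\to m$ are $m\times n$ matrices over $\mathbb N$; $f;g$ denotes $f$ followed by $g$, i.e. for $A\colon n\to k$, $B\colon k\to m$, $A;B=B\cdot A$; $A\otimes B=\begin{pmatrix}A&0\\0&B\end{pmatrix}$. $\mathrm{del}_k\colon k\to0$ is the $0\times k$ matrix and $\mathrm{zero}_{k}\colon0\to k$ the $k\times0$ matrix. Atoms: $\mathrm{cp}_1=\begin{pmatrix}1\\1\end{pmatrix}\colon1\to2$, $\mathrm{del}_1$, $\mathrm{add}_1=(1\ 1)\colon2\to1$, $\mathrm{zero}_1$, $\sigma_{1,1}=\begin{pmatrix}0&1\\1&0\end{pmatrix}$, $\mathrm{id}_1=(1)$. Weights: $w(n)=n$ on objects, $w(g)=\max\{m,n\}$ for an atom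 $g\colon n\to m$. Monoidal decompositions $D(f)$ of $f\colon a\to b$: a leaf $(f)$ if $f$ is an atom; $(d_1\otimes d_2)$ with $d_i\in D(f_i)$, $f=f_1\otimes f_2$; $(d_1;_jd_2)$ with $d_1\in D(f_1\colon a\to j)$, $d_2\in D(f_2\colon j\to b)$, $f=f_1;f_2$. Width: $\mathrm{wd}((f))=w(f)$, $\mathrm{wd}(d_1\otimes d_2)=\max\{\mathrm{wd}(d_1),\mathrm{wd}(d_2)\}$, $\mathrm{wd}(d_1;_jd_2)=\max\{\mathrm{wd}(d_1),j,\mathrm{wd}(d_2)\}$. -}

module Defs where

open import Data.Nat using (ℕ; zero; suc; _+_; _*_; _⊔_)
open import Data.Fin using (Fin; zero; suc; splitAt)
open import Data.Sum using (inj₁; inj₂)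
open import Data.Product using (Σ; _,_)
open import Relation.Binary.PropositionalEquality using (_≡_)

-- A morphism n → m of Mat_ℕ: an m × n matrix over ℕ,
-- given as a function  row index (Fin m) → column index (Fin n) → ℕ.
Mat : ℕ → ℕ → Set
Mat n m = Fin m → Fin n → ℕ

_≈ₘ_ : ∀ {n m} → Mat n m → Mat n m → Set
A ≈ₘ B = ∀ i j → A i j ≡ B i j

sumFin : (k : ℕ) → (Fin k → ℕ) → ℕ
sumFin zero    g = 0
sumFin (suc k) g = g zero + sumFin k (λ x → g (suc x))

-- diagrammatic composition  A ; B = B · A
_⨾_ : ∀ {n k m} → Mat n k → Mat k m → Mat n m
_⨾_ {k = k} A B i j = sumFin k (λ l → B i l * A l j)

_⊗ₘ_ : ∀ {n m n' m'} → Mat n m → Mat n' m' → Mat (n + n') (m + m')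
_⊗ₘ_ {n} {m} A B i j with splitAt m i | splitAt n j
... | inj₁ i' | inj₁ j' = A i' j'
... | inj₂ i' | inj₂ j' = B i' j'
... | inj₁ _  | inj₂ _  = 0
... | inj₂ _  | inj₁ _  = 0

idₘ : (k : ℕ) → Mat k k
idₘ (suc k) zero    zero    = 1
idₘ (suc k) zero    (suc j) = 0
idₘ (suc k) (suc i) zero    = 0
idₘ (suc k) (suc i) (suc j) = idₘ k i j

delₘ : (k : ℕ) → Mat k 0
delₘ k ()

zeroₘ : (k : ℕ) → Mat 0 k
zeroₘ k i ()

data Atom : ℕ → ℕ → Set where
  cp   : Atom 1 2
  del  : Atom 1 0
  add  : Atom 2 1
  zer  : Atom 0 1
  swap : Atom 2 2
  id1  : Atom 1 1

atomMat : ∀ {n m} → Atom n m → Mat n m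
atomMat cp   i j = 1
atomMat del  ()
atomMat add  i j = 1
atomMat zer  i ()
atomMat swap zero       zero       = 0
atomMat swap zero       (suc zero) = 1
atomMat swap (suc zero) zero       = 1
atomMat swap (suc zero) (suc zero) = 0
atomMat id1  i j = 1

wAtom : ∀ {n m} → Atom n m → ℕ
wAtom {n} {m} _ = m ⊔ n

data Term : ℕ → ℕ → Set where
  leaf : ∀ {n m} → Atom n m → Term n m
  _⊗ₜ_ : ∀ {n m n' m'} → Term n m → Term n' m' → Term (n + n') (m + m')
  seq  : ∀ {n m} (j : ℕ) → Term n j → Term j m → Term n m

⟦_⟧ : ∀ {n m} → Term n m → Mat n m
⟦ leaf g ⟧    = atomMat g
⟦ t ⊗ₜ u ⟧    = ⟦ t ⟧ ⊗ₘ ⟦ u ⟧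
⟦ seq j t u ⟧ = ⟦ t ⟧ ⨾ ⟦ u ⟧

wdₜ : ∀ {n m} → Term n m → ℕ
wdₜ (leaf g)    = wAtom g
wdₜ (t ⊗ₜ u)    = wdₜ t ⊔ wdₜ u
wdₜ (seq j t u) = wdₜ t ⊔ j ⊔ wdₜ u

Decomp : ∀ {n m} → Mat n m → Set
Decomp {n} {m} f = Σ (Term n m) (λ t → ⟦ t ⟧ ≈ₘ f)

wd : ∀ {n m} {f : Mat n m} → Decomp f → ℕ
wd (t , _) = wdₜ t

{-# OPTIONS --safe #-}
-- Deleting the last rows of a decomposed matrix can be pushed down the decomposition: in
-- d₁ ;ⱼ d₂ only d₂ is affected, in d₁ ⊗ d₂ the kept rows are an initial segment of the rows
-- of d₁, followed (when all of those are kept) by an initial segment of the rows of d₂, and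
-- an atom is replaced by a smaller atom or by a tensor of del's. No intermediate object j
-- changes and no atom gets heavier, so the width cannot grow. Deleting columns is deleting
-- rows of the transpose, and transposing a decomposition (cp ↔ add, del ↔ zer, reversing
-- composites) preserves its width.
module Submission where

open import Defs
open import Data.Nat using (ℕ; zero; suc; _+_; _*_; _⊔_; _∸_; _≤_; z≤n; s≤s; _≤?_)
open import Data.Nat.Properties
  using (+-assoc; +-identityʳ; *-identityˡ; *-comm; ⊔-comm; ⊔-assoc; ⊔-mono-≤; ⊔-monoʳ-≤;
         ≤-refl; ≤-trans; ≤-reflexive; +-monoʳ-≤; ≰⇒≥; m+[n∸m]≡n; m≤n+o⇒m∸n≤o)
open import Data.Fin using (Fin; splitAt; inject≤; toℕ; _↑ˡ_; _↑ʳ_)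
import Data.Fin as Fin
open import Data.Fin.Properties
  using (toℕ-injective; toℕ-inject≤; toℕ-↑ˡ; toℕ-↑ʳ; inject≤-refl;
         splitAt-↑ˡ; splitAt-↑ʳ; splitAt⁻¹-↑ˡ; splitAt⁻¹-↑ʳ)
open import Data.Product using (Σ; _×_; _,_)
open import Data.Sum using (_⊎_; inj₁; inj₂)
open import Function using (_∘_)
open import Relation.Nullary using (yes; no)
open import Relation.Binary.PropositionalEquality

↑-elim : ∀ {m n} (P : Fin (m + n) → Set) →
         (∀ i → P (i ↑ˡ n)) → (∀ i → P (m ↑ʳ i)) → ∀ i → P i
↑-elim {m} P left right i with splitAt m i in eq
... | inj₁ a = subst P (splitAt⁻¹-↑ˡ eq) (left a)
... | inj₂ b = subst P (splitAt⁻¹-↑ʳ eq) (right b)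

inject≤-↑ˡ : ∀ {p r m m'} (i : Fin p) .(p≤m : p ≤ m) .(le : p + r ≤ m + m') →
             inject≤ (i ↑ˡ r) le ≡ inject≤ i p≤m ↑ˡ m'
inject≤-↑ˡ {r = r} {m' = m'} i p≤m le = toℕ-injective (begin
  toℕ (inject≤ (i ↑ˡ r) le)   ≡⟨ toℕ-inject≤ (i ↑ˡ r) le ⟩
  toℕ (i ↑ˡ r)                ≡⟨ toℕ-↑ˡ i r ⟩
  toℕ i                       ≡⟨ toℕ-inject≤ i p≤m ⟨
  toℕ (inject≤ i p≤m)         ≡⟨ toℕ-↑ˡ (inject≤ i p≤m) m' ⟨
  toℕ (inject≤ i p≤m ↑ˡ m')   ∎)
  where open ≡-Reasoning

inject≤-↑ʳ : ∀ {r m m'} (i : Fin r) .(r≤m' : r ≤ m') .(le : m + r ≤ m + m') →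
             inject≤ (m ↑ʳ i) le ≡ m ↑ʳ inject≤ i r≤m'
inject≤-↑ʳ {m = m} i r≤m' le = toℕ-injective (begin
  toℕ (inject≤ (m ↑ʳ i) le)   ≡⟨ toℕ-inject≤ (m ↑ʳ i) le ⟩
  toℕ (m ↑ʳ i)                ≡⟨ toℕ-↑ʳ m i ⟩
  m + toℕ i                   ≡⟨ cong (m +_) (toℕ-inject≤ i r≤m') ⟨
  m + toℕ (inject≤ i r≤m')    ≡⟨ toℕ-↑ʳ m (inject≤ i r≤m') ⟨
  toℕ (m ↑ʳ inject≤ i r≤m')   ∎)
  where open ≡-Reasoning

sumFin-cong : ∀ k {g h : Fin k → ℕ} → (∀ l → g l ≡ h l) → sumFin k g ≡ sumFin k h
sumFin-cong zero    g≗h = refl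
sumFin-cong (suc k) g≗h = cong₂ _+_ (g≗h Fin.zero) (sumFin-cong k (g≗h ∘ Fin.suc))

sumFin-zero : ∀ k → sumFin k (λ _ → 0) ≡ 0
sumFin-zero zero    = refl
sumFin-zero (suc k) = sumFin-zero k

sumFin-+ : ∀ a b (g : Fin (a + b) → ℕ) →
           sumFin (a + b) g ≡ sumFin a (g ∘ (_↑ˡ b)) + sumFin b (g ∘ (a ↑ʳ_))
sumFin-+ zero    b g = refl
sumFin-+ (suc a) b g =
  trans (cong (g Fin.zero +_) (sumFin-+ a b (g ∘ Fin.suc))) (sym (+-assoc (g Fin.zero) _ _))

sumFin-idₘ : ∀ k (i : Fin k) (g : Fin k → ℕ) → sumFin k (λ l → idₘ k i l * g l) ≡ g i
sumFin-idₘ (suc k) Fin.zero    g =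
  trans (cong₂ _+_ (*-identityˡ (g Fin.zero)) (sumFin-zero k)) (+-identityʳ (g Fin.zero))
sumFin-idₘ (suc k) (Fin.suc i) g = sumFin-idₘ k i (g ∘ Fin.suc)

module _ {n m : ℕ} where

  ≈ₘ-sym : {A B : Mat n m} → A ≈ₘ B → B ≈ₘ A
  ≈ₘ-sym A≈B i j = sym (A≈B i j)

  ≈ₘ-trans : {A B C : Mat n m} → A ≈ₘ B → B ≈ₘ C → A ≈ₘ C
  ≈ₘ-trans A≈B B≈C i j = trans (A≈B i j) (B≈C i j)

infix 25 _ᵀ

_ᵀ : ∀ {n m} → Mat n m → Mat m n
(A ᵀ) i j = A j i

idₘ-ᵀ : ∀ {k} → idₘ k ᵀ ≈ₘ idₘ k
idₘ-ᵀ {suc k} Fin.zero    Fin.zero    = refl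
idₘ-ᵀ {suc k} Fin.zero    (Fin.suc j) = refl
idₘ-ᵀ {suc k} (Fin.suc i) Fin.zero    = refl
idₘ-ᵀ {suc k} (Fin.suc i) (Fin.suc j) = idₘ-ᵀ i j

module _ {n k m : ℕ} where

  ⨾-cong : {A A' : Mat n k} {B B' : Mat k m} → A ≈ₘ A' → B ≈ₘ B' → (A ⨾ B) ≈ₘ (A' ⨾ B')
  ⨾-cong A≈A' B≈B' i j = sumFin-cong k (λ l → cong₂ _*_ (B≈B' i l) (A≈A' l j))

  ⨾-ᵀ : (A : Mat n k) (B : Mat k m) → (A ⨾ B) ᵀ ≈ₘ (B ᵀ ⨾ A ᵀ)
  ⨾-ᵀ A B i j = sumFin-cong k (λ l → *-comm (B j l) (A l i))

module _ {n m n' m' : ℕ} where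

  ⊗ₘ-cong : {A A' : Mat n m} {B B' : Mat n' m'} → A ≈ₘ A' → B ≈ₘ B' → (A ⊗ₘ B) ≈ₘ (A' ⊗ₘ B')
  ⊗ₘ-cong A≈A' B≈B' i j with splitAt m i | splitAt n j
  ... | inj₁ a | inj₁ b = A≈A' a b
  ... | inj₁ _ | inj₂ _ = refl
  ... | inj₂ _ | inj₁ _ = refl
  ... | inj₂ a | inj₂ b = B≈B' a b

  ⊗ₘ-ᵀ : (A : Mat n m) (B : Mat n' m') → (A ⊗ₘ B) ᵀ ≈ₘ (A ᵀ ⊗ₘ B ᵀ)
  ⊗ₘ-ᵀ A B i j with splitAt m j | splitAt n i
  ... | inj₁ _ | inj₁ _ = refl
  ... | inj₁ _ | inj₂ _ = refl
  ... | inj₂ _ | inj₁ _ = refl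
  ... | inj₂ _ | inj₂ _ = refl

  module _ (A : Mat n m) (B : Mat n' m') (i : Fin m) where

    ⊗ₘ-↑ˡ-↑ˡ : ∀ j → (A ⊗ₘ B) (i ↑ˡ m') (j ↑ˡ n') ≡ A i j
    ⊗ₘ-↑ˡ-↑ˡ j rewrite splitAt-↑ˡ m i m' | splitAt-↑ˡ n j n' = refl

    ⊗ₘ-↑ˡ-↑ʳ : ∀ j → (A ⊗ₘ B) (i ↑ˡ m') (n ↑ʳ j) ≡ 0
    ⊗ₘ-↑ˡ-↑ʳ j rewrite splitAt-↑ˡ m i m' | splitAt-↑ʳ n n' j = refl

  module _ {p p' : ℕ} (A : Mat n m) (B : Mat n' m') (A' : Mat n p) (B' : Mat n' p') where

    ⊗ₘ-↑ˡ-row : ∀ {i i'} → (∀ j → A i j ≡ A' i' j) →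
                ∀ j → (A ⊗ₘ B) (i ↑ˡ m') j ≡ (A' ⊗ₘ B') (i' ↑ˡ p') j
    ⊗ₘ-↑ˡ-row {i} {i'} rows j rewrite splitAt-↑ˡ m i m' | splitAt-↑ˡ p i' p' with splitAt n j
    ... | inj₁ c = rows c
    ... | inj₂ _ = refl

    ⊗ₘ-↑ʳ-row : ∀ {i i'} → (∀ j → B i j ≡ B' i' j) →
                ∀ j → (A ⊗ₘ B) (m ↑ʳ i) j ≡ (A' ⊗ₘ B') (p ↑ʳ i') j
    ⊗ₘ-↑ʳ-row {i} {i'} rows j rewrite splitAt-↑ʳ m m' i | splitAt-↑ʳ p p' i' with splitAt n j
    ... | inj₁ _ = refl
    ... | inj₂ c = rows c

Decomp-resp : ∀ {n m} {f g : Mat n m} → f ≈ₘ g → Decomp f → Decomp g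
Decomp-resp f≈g (t , ⟦t⟧≈f) = t , ≈ₘ-trans ⟦t⟧≈f f≈g

Decomp-⨾ : ∀ {n k m} {A : Mat n k} {B : Mat k m} → Decomp A → Decomp B → Decomp (A ⨾ B)
Decomp-⨾ {k = k} (t , ⟦t⟧≈A) (u , ⟦u⟧≈B) = seq k t u , ⨾-cong ⟦t⟧≈A ⟦u⟧≈B

Decomp-⊗ : ∀ {n m n' m'} {A : Mat n m} {B : Mat n' m'} → Decomp A → Decomp B → Decomp (A ⊗ₘ B)
Decomp-⊗ (t , ⟦t⟧≈A) (u , ⟦u⟧≈B) = t ⊗ₜ u , ⊗ₘ-cong ⟦t⟧≈A ⟦u⟧≈B

atomᵀ : ∀ {n m} → Atom n m → Atom m n
atomᵀ cp   = add
atomᵀ del  = zer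
atomᵀ add  = cp
atomᵀ zer  = del
atomᵀ swap = swap
atomᵀ id1  = id1

atomMat-ᵀ : ∀ {n m} (g : Atom n m) → atomMat (atomᵀ g) ≈ₘ atomMat g ᵀ
atomMat-ᵀ cp   _ _ = refl
atomMat-ᵀ del  _ ()
atomMat-ᵀ add  _ _ = refl
atomMat-ᵀ zer  ()
atomMat-ᵀ swap Fin.zero           Fin.zero           = refl
atomMat-ᵀ swap Fin.zero           (Fin.suc Fin.zero) = refl
atomMat-ᵀ swap (Fin.suc Fin.zero) Fin.zero           = refl
atomMat-ᵀ swap (Fin.suc Fin.zero) (Fin.suc Fin.zero) = refl
atomMat-ᵀ id1  _ _ = refl

infix 25 _ᵀₜ

_ᵀₜ : ∀ {n m} → Term n m → Term m n
leaf g ᵀₜ    = leaf (atomᵀ g)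
(t ⊗ₜ u) ᵀₜ  = t ᵀₜ ⊗ₜ u ᵀₜ
seq j t u ᵀₜ = seq j (u ᵀₜ) (t ᵀₜ)

⟦ᵀₜ⟧ : ∀ {n m} (t : Term n m) → ⟦ t ᵀₜ ⟧ ≈ₘ ⟦ t ⟧ ᵀ
⟦ᵀₜ⟧ (leaf g)    = atomMat-ᵀ g
⟦ᵀₜ⟧ (t ⊗ₜ u)    = ≈ₘ-trans (⊗ₘ-cong (⟦ᵀₜ⟧ t) (⟦ᵀₜ⟧ u)) (≈ₘ-sym (⊗ₘ-ᵀ ⟦ t ⟧ ⟦ u ⟧))
⟦ᵀₜ⟧ (seq _ t u) = ≈ₘ-trans (⨾-cong (⟦ᵀₜ⟧ u) (⟦ᵀₜ⟧ t)) (≈ₘ-sym (⨾-ᵀ ⟦ t ⟧ ⟦ u ⟧))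

wdₜ-ᵀ : ∀ {n m} (t : Term n m) → wdₜ (t ᵀₜ) ≡ wdₜ t
wdₜ-ᵀ {n} {m} (leaf g) = ⊔-comm n m
wdₜ-ᵀ (t ⊗ₜ u)         = cong₂ _⊔_ (wdₜ-ᵀ t) (wdₜ-ᵀ u)
wdₜ-ᵀ (seq j t u) rewrite wdₜ-ᵀ t | wdₜ-ᵀ u = begin
  wdₜ u ⊔ j ⊔ wdₜ t    ≡⟨ ⊔-comm (wdₜ u ⊔ j) (wdₜ t) ⟩
  wdₜ t ⊔ (wdₜ u ⊔ j)  ≡⟨ cong (wdₜ t ⊔_) (⊔-comm (wdₜ u) j) ⟩
  wdₜ t ⊔ (j ⊔ wdₜ u)  ≡⟨ ⊔-assoc (wdₜ t) j (wdₜ u) ⟨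
  wdₜ t ⊔ j ⊔ wdₜ u    ∎
  where open ≡-Reasoning

Decomp-ᵀ : ∀ {n m} {f : Mat n m} → Decomp f → Decomp (f ᵀ)
Decomp-ᵀ (t , ⟦t⟧≈f) = t ᵀₜ , ≈ₘ-trans (⟦ᵀₜ⟧ t) (λ i j → ⟦t⟧≈f j i)

wd-Decomp-ᵀ : ∀ {n m} {f : Mat n m} (d : Decomp f) → wd (Decomp-ᵀ d) ≡ wd d
wd-Decomp-ᵀ (t , _) = wdₜ-ᵀ t

takeRows : ∀ {n m p} → .(p ≤ m) → Mat n m → Mat n p
takeRows p≤m A i = A (inject≤ i p≤m)

module _ {n m n' m' p r : ℕ} (A : Mat n m) (B : Mat n' m') (p≤m : p ≤ m) (r≤m' : r ≤ m') where

  takeRows-⊗ₘ-↑ˡ : .(le : p + r ≤ m + m') → ∀ a j →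
                   takeRows le (A ⊗ₘ B) (a ↑ˡ r) j ≡ (takeRows p≤m A ⊗ₘ takeRows r≤m' B) (a ↑ˡ r) j
  takeRows-⊗ₘ-↑ˡ le a j = trans (cong (λ x → (A ⊗ₘ B) x j) (inject≤-↑ˡ a p≤m le))
                                (⊗ₘ-↑ˡ-row A B (takeRows p≤m A) (takeRows r≤m' B) (λ _ → refl) j)

takeRows-⊗ₘ : ∀ {n m n' m' p r} (A : Mat n m) (B : Mat n' m') (p≤m : p ≤ m) (r≤m' : r ≤ m')
              .(le : p + r ≤ m + m') → p ≡ m ⊎ r ≡ 0 →
              takeRows le (A ⊗ₘ B) ≈ₘ (takeRows p≤m A ⊗ₘ takeRows r≤m' B)
takeRows-⊗ₘ A B p≤m r≤m' le (inj₁ refl) = ↑-elim _ (takeRows-⊗ₘ-↑ˡ A B p≤m r≤m' le) bottom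
  where
  bottom : ∀ b j → takeRows le (A ⊗ₘ B) (_ ↑ʳ b) j ≡ (takeRows p≤m A ⊗ₘ takeRows r≤m' B) (_ ↑ʳ b) j
  bottom b j = trans (cong (λ x → (A ⊗ₘ B) x j) (inject≤-↑ʳ b r≤m' le))
                     (⊗ₘ-↑ʳ-row A B (takeRows p≤m A) (takeRows r≤m' B) (λ _ → refl) j)
takeRows-⊗ₘ A B p≤m r≤m' le (inj₂ refl) = ↑-elim _ (takeRows-⊗ₘ-↑ˡ A B p≤m r≤m' le) (λ ())

⨾-idₘ⊗delₘ : ∀ {n} p k (f : Mat n (p + k)) →
             (f ⨾ (idₘ p ⊗ₘ delₘ k)) ≈ₘ takeRows (+-monoʳ-≤ p z≤n) f
⨾-idₘ⊗delₘ p k f = ↑-elim _ selected (λ ())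
  where
  open ≡-Reasoning
  S = idₘ p ⊗ₘ delₘ k
  selected : ∀ a j → (f ⨾ S) (a ↑ˡ 0) j ≡ takeRows (+-monoʳ-≤ p z≤n) f (a ↑ˡ 0) j
  selected a j = begin
    sumFin (p + k) (λ l → S (a ↑ˡ 0) l * f l j)
      ≡⟨ sumFin-+ p k _ ⟩
    sumFin p (λ l → S (a ↑ˡ 0) (l ↑ˡ k) * f (l ↑ˡ k) j)
      + sumFin k (λ l → S (a ↑ˡ 0) (p ↑ʳ l) * f (p ↑ʳ l) j)
      ≡⟨ cong₂ _+_ (sumFin-cong p (λ l → cong (_* f (l ↑ˡ k) j) (⊗ₘ-↑ˡ-↑ˡ (idₘ p) (delₘ k) a l)))
                   (sumFin-cong k (λ l → cong (_* f (p ↑ʳ l) j) (⊗ₘ-↑ˡ-↑ʳ (idₘ p) (delₘ k) a l))) ⟩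
    sumFin p (λ l → idₘ p a l * f (l ↑ˡ k) j) + sumFin k (λ _ → 0)
      ≡⟨ cong₂ _+_ (sumFin-idₘ p a (λ l → f (l ↑ˡ k) j)) (sumFin-zero k) ⟩
    f (a ↑ˡ k) j + 0
      ≡⟨ +-identityʳ _ ⟩
    f (a ↑ˡ k) j
      ≡⟨ cong (λ x → f (x ↑ˡ k) j) (inject≤-refl a ≤-refl) ⟨
    f (inject≤ a ≤-refl ↑ˡ k) j
      ≡⟨ cong (λ x → f x j) (inject≤-↑ˡ a ≤-refl (+-monoʳ-≤ p z≤n)) ⟨
    f (inject≤ (a ↑ˡ 0) (+-monoʳ-≤ p z≤n)) j
      ∎

delₘ-ᵀ : ∀ {k} → delₘ k ᵀ ≈ₘ zeroₘ k
delₘ-ᵀ _ ()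

ᵀ-⨾-idₘ⊗delₘ : ∀ {m} q k (f : Mat (q + k) m) →
               ((f ᵀ ⨾ (idₘ q ⊗ₘ delₘ k)) ᵀ) ≈ₘ ((idₘ q ⊗ₘ zeroₘ k) ⨾ f)
ᵀ-⨾-idₘ⊗delₘ q k f =
  ≈ₘ-trans (⨾-ᵀ (f ᵀ) (idₘ q ⊗ₘ delₘ k))
           (⨾-cong {B = f} {B' = f}
                   (≈ₘ-trans (⊗ₘ-ᵀ (idₘ q) (delₘ k)) (⊗ₘ-cong (idₘ-ᵀ {q}) (delₘ-ᵀ {k})))
                   (λ _ _ → refl))

RowRestriction : ∀ {n m} → Term n m → ℕ → Set
RowRestriction {m = m} t p = (p≤m : p ≤ m) → Σ (Decomp (takeRows p≤m ⟦ t ⟧)) (λ d → wd d ≤ wdₜ t)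

restrictAll : ∀ {n m} (t : Term n m) → RowRestriction t m
restrictAll t m≤m = (t , λ i j → cong (λ x → ⟦ t ⟧ x j) (sym (inject≤-refl i m≤m))) , ≤-refl

discard : ∀ n → Term n 0
discard zero    = seq 1 (leaf zer) (leaf del)
discard (suc n) = leaf del ⊗ₜ discard n

wdₜ-discard : ∀ n → wdₜ (discard n) ≡ 1
wdₜ-discard zero    = refl
wdₜ-discard (suc n) = cong (1 ⊔_) (wdₜ-discard n)

1≤wAtom : ∀ {n m} (g : Atom n m) → 1 ≤ wAtom g
1≤wAtom cp   = s≤s z≤n
1≤wAtom del  = s≤s z≤n
1≤wAtom add  = s≤s z≤n
1≤wAtom zer  = s≤s z≤n
1≤wAtom swap = s≤s z≤n
1≤wAtom id1  = s≤s z≤n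

restrictAtom : ∀ {n m} (g : Atom n m) p → RowRestriction (leaf g) p
restrictAtom {n} g zero _ = (discard n , λ ()) , subst (_≤ wAtom g) (sym (wdₜ-discard n)) (1≤wAtom g)
restrictAtom cp   1 _ = (leaf id1 , λ _ _ → refl) , s≤s z≤n
restrictAtom swap 1 _ =
  (leaf del ⊗ₜ leaf id1 , λ { Fin.zero Fin.zero → refl ; Fin.zero (Fin.suc Fin.zero) → refl }) , s≤s z≤n
restrictAtom cp   2 = restrictAll (leaf cp)
restrictAtom add  1 = restrictAll (leaf add)
restrictAtom zer  1 = restrictAll (leaf zer)
restrictAtom swap 2 = restrictAll (leaf swap)
restrictAtom id1  1 = restrictAll (leaf id1)
restrictAtom cp   (suc (suc (suc _))) (s≤s (s≤s ()))
restrictAtom del  (suc _)             ()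
restrictAtom add  (suc (suc _))       (s≤s ())
restrictAtom zer  (suc (suc _))       (s≤s ())
restrictAtom swap (suc (suc (suc _))) (s≤s (s≤s ()))
restrictAtom id1  (suc (suc _))       (s≤s ())

RowRestriction-⊗ : ∀ {n m n' m' p r} (t : Term n m) (u : Term n' m') (p≤m : p ≤ m) (r≤m' : r ≤ m') →
                   p ≡ m ⊎ r ≡ 0 → RowRestriction t p → RowRestriction u r → RowRestriction (t ⊗ₜ u) (p + r)
RowRestriction-⊗ t u p≤m r≤m' keep restrict-t restrict-u le =
  let (dt , dt≤t) = restrict-t p≤m
      (du , du≤u) = restrict-u r≤m'
  in  Decomp-resp (≈ₘ-sym (takeRows-⊗ₘ ⟦ t ⟧ ⟦ u ⟧ p≤m r≤m' le keep)) (Decomp-⊗ dt du) , ⊔-mono-≤ dt≤t du≤u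

restrictRows : ∀ {n m} (t : Term n m) p → RowRestriction t p
restrictRows (leaf g) = restrictAtom g
restrictRows (seq _ t u) p p≤m =
  let (du , du≤u) = restrictRows u p p≤m
  in  Decomp-⨾ (t , λ _ _ → refl) du , ⊔-monoʳ-≤ (wdₜ t ⊔ _) du≤u
restrictRows (_⊗ₜ_ {m = m} t u) p p≤m+m' with p ≤? m
... | yes p≤m = subst (RowRestriction (t ⊗ₜ u)) (+-identityʳ p)
                  (RowRestriction-⊗ t u p≤m z≤n (inj₂ refl) (restrictRows t p) (restrictRows u 0)) p≤m+m'
... | no p≰m  = subst (RowRestriction (t ⊗ₜ u)) (m+[n∸m]≡n (≰⇒≥ p≰m))
                  (RowRestriction-⊗ t u ≤-refl (m≤n+o⇒m∸n≤o p m p≤m+m') (inj₁ refl)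
                     (restrictRows t m) (restrictRows u (p ∸ m))) p≤m+m'

restrictDecomp : ∀ {n m p} {f : Mat n m} (p≤m : p ≤ m) (d : Decomp f) →
                 Σ (Decomp (takeRows p≤m f)) (λ d' → wd d' ≤ wd d)
restrictDecomp p≤m (t , ⟦t⟧≈f) =
  let (d , d≤t) = restrictRows t _ p≤m
  in  Decomp-resp (λ i j → ⟦t⟧≈f (inject≤ i p≤m) j) d , d≤t

lemma4p9 : ((n p k : ℕ) (f : Mat n (p + k)) (d : Decomp f) →
    Σ (Decomp (f ⨾ (idₘ p ⊗ₘ delₘ k))) (λ dD → wd dD ≤ wd d))
    ×
    ((q k' m : ℕ) (f : Mat (q + k') m) (d : Decomp f) →
    Σ (Decomp ((idₘ q ⊗ₘ zeroₘ k') ⨾ f)) (λ dZ → wd dZ ≤ wd d))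
lemma4p9 = deleteRows , deleteCols
  where
  deleteRows : (n p k : ℕ) (f : Mat n (p + k)) (d : Decomp f) →
               Σ (Decomp (f ⨾ (idₘ p ⊗ₘ delₘ k))) (λ dD → wd dD ≤ wd d)
  deleteRows n p k f d =
    let (dD , dD≤d) = restrictDecomp (+-monoʳ-≤ p z≤n) d
    in  Decomp-resp (≈ₘ-sym (⨾-idₘ⊗delₘ p k f)) dD , dD≤d

  deleteCols : (q k' m : ℕ) (f : Mat (q + k') m) (d : Decomp f) →
               Σ (Decomp ((idₘ q ⊗ₘ zeroₘ k') ⨾ f)) (λ dZ → wd dZ ≤ wd d)
  deleteCols q k' m f d =
    let (dD , dD≤dᵀ) = deleteRows m q k' (f ᵀ) (Decomp-ᵀ d)
    in  Decomp-resp (ᵀ-⨾-idₘ⊗delₘ q k' f) (Decomp-ᵀ dD)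
      , ≤-trans (≤-reflexive (wd-Decomp-ᵀ dD)) (≤-trans dD≤dᵀ (≤-reflexive (wd-Decomp-ᵀ d)))
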